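{- Let $t$ be a nonnegative integer, let $X$ be an EW matrix of order $4t+2$, and let $x_1,\ldots,x_{4t+2}$ be the invariant factors of $X$. Then $x_1=1$ and $x_2=2$.
   Context: For $n\equiv 2\pmod 4$, a $\{1,-1\}$-matrix $B$ of order $n$ is called an EW matrix if \[ BB^\top=B^\top B=\begin{pmatrix}(n-2)I_{n/2}+2J_{n/2} & O\\ O & (n-2)I_{n/2}+2J_{n/2}\end{pmatrix}, \] where $I$ is the identity matrix, $J$ the all-ones matrix and $O$ the zero matrix. The invariant factors of an $n\times n$ integer matrix $M$ are the diagonal entries $m_1,\dots,m_n$ of its Smith normal form: the unique diagonal matrix with nonnegative entries, $m_i\mid m_{i+1}$, equivalent to $M$ via $M\mapsto PMQ$ with $P,Q$ unimodular integer matrices. -}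

module Defs where

open import Data.Nat as ℕ using (ℕ; zero; suc)
import Data.Nat.DivMod
open import Data.Fin using (Fin; toℕ)
import Data.Fin as Fin
open import Data.Integer using (ℤ; +_; -_; _+_; _*_; _≤_)
open import Data.Integer.Divisibility using (_∣_)
open import Data.Product using (Σ; _×_; _,_)
open import Data.Sum using (_⊎_)
open import Data.Bool using (Bool; true; false; if_then_else_)
open import Relation.Binary.PropositionalEquality using (_≡_)
open import Relation.Nullary.Decidable using (⌊_⌋)

Matrix : ℕ → Set
Matrix n = Fin n → Fin n → ℤ

sumFin : ∀ {n} → (Fin n → ℤ) → ℤ
sumFin {zero}  f = + 0
sumFin {suc n} f = f Fin.zero + sumFin (λ k → f (Fin.suc k))

_⊗_ : ∀ {n} → Matrix n → Matrix n → Matrix n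
(A ⊗ B) i j = sumFin (λ k → A i k * B k j)

infixl 7 _⊗_

transpose : ∀ {n} → Matrix n → Matrix n
transpose A i j = A j i

δ : ∀ {n} → Fin n → Fin n → ℤ
δ i j = if ⌊ i Fin.≟ j ⌋ then + 1 else + 0

identity : ∀ {n} → Matrix n
identity = δ

infix 4 _≐_
_≐_ : ∀ {n} → Matrix n → Matrix n → Set
A ≐ B = ∀ i j → A i j ≡ B i j

Unimodular : ∀ {n} → Matrix n → Set
Unimodular {n} P = Σ (Matrix n) λ Q → (P ⊗ Q ≐ identity) × (Q ⊗ P ≐ identity)

diag : ∀ {n} → (Fin n → ℤ) → Matrix n
diag d i j = if ⌊ i Fin.≟ j ⌋ then d i else + 0

-- d (listing m_1,…,m_n as d 0,…,d (n-1)) is the Smith normal form diagonal of M.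
IsSmithNormalForm : ∀ {n} → Matrix n → (Fin n → ℤ) → Set
IsSmithNormalForm {n} M d =
  (∀ i → + 0 ≤ d i) ×
  (∀ (i j : Fin n) → toℕ j ≡ suc (toℕ i) → d i ∣ d j) ×
  Σ (Matrix n) λ P → Σ (Matrix n) λ Q →
    Unimodular P × Unimodular Q × (P ⊗ M ⊗ Q ≐ diag d)

-- Invariant factors of M (by uniqueness of the SNF, any such d).
InvariantFactors : ∀ {n} → Matrix n → (Fin n → ℤ) → Set
InvariantFactors = IsSmithNormalForm

IsPM1 : ∀ {n} → Matrix n → Set
IsPM1 A = ∀ i j → (A i j ≡ + 1) ⊎ (A i j ≡ - + 1)

firstHalf : ∀ {n} → ℕ → Fin n → Bool
firstHalf m i = ⌊ suc (toℕ i) ℕ.≤? m ⌋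

sameHalf : ∀ {n} → ℕ → Fin n → Fin n → Bool
sameHalf m i j with firstHalf m i | firstHalf m j
... | true  | true  = true
... | false | false = true
... | _     | _     = false

-- The block matrix diag((n-2)I_{n/2} + 2J_{n/2}, (n-2)I_{n/2} + 2J_{n/2}) of order n
-- (used for n even; the first half consists of indices i with toℕ i < n/2).
EWGram : (n : ℕ) → Matrix n
EWGram n i j =
  (+ (n ℕ.∸ 2)) * δ i j + (if sameHalf (n ℕ./ 2) i j then + 2 else + 0)

-- EW matrix of order n (the paper takes n ≡ 2 mod 4).
IsEW : (n : ℕ) → Matrix n → Set
IsEW n B =
  IsPM1 B × (B ⊗ transpose B ≐ EWGram n) × (transpose B ⊗ B ≐ EWGram n)

module Submission where

-- Write X = A · diag(x) · B with A, B the inverses of the unimodular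
-- matrices of the Smith normal form.  Two facts about any integer matrix
-- follow from this factorisation:
--   * x₀ divides every entry of X (all x_k are multiples of x₀);
--   * modulo x₁ the matrix X is congruent to a rank-one matrix, so x₁
--     divides every 2 × 2 minor of X.
-- A ±1 matrix is congruent to the all-ones (rank-one) matrix modulo 2, and
-- rank one modulo 2 survives multiplication by P and Q; hence the minor
-- x₀ x₁ − 0 · 0 of diag(x) = P X Q is even.
-- For an EW matrix the rows 0 and n/2 lie in different halves, so they are
-- orthogonal; orthogonal ±1 rows are not proportional, which produces a
-- 2 × 2 minor equal to ±2.  Thus x₀ ∣ ±1 gives x₀ = 1, and then x₁ is an
-- even divisor of 2, i.e. x₁ = 2.

open import Defs
open import Data.Fin using (Fin; zero; suc; toℕ; fromℕ<)
import Data.Fin as Fin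
import Data.Fin.Properties as FinP
open import Data.Integer using (ℤ; +_)
open import Data.Product using (Σ; _×_; _,_)
open import Relation.Binary.PropositionalEquality
  using (_≡_; _≢_; refl; sym; trans; cong; cong₂; subst; module ≡-Reasoning)

module IntegerMatrices where

  open import Data.Nat as ℕ using (ℕ)
  import Data.Nat.Properties as ℕP
  import Data.Nat.DivMod as ℕDiv
  open import Data.Nat.Divisibility using (∣1⇒≡1; ∣-antisym)
  open import Data.Integer using (-_; _+_; _*_; _-_; +0; _≤_; +≤+; ∣_∣)
  import Data.Integer.Properties as ℤP
  import Data.Integer.Divisibility as Unsigned
  open import Data.Integer.Divisibility.Signed
    using (_∣_; divides; ∣-refl; ∣-trans; ∣ᵤ⇒∣; ∣⇒∣ᵤ; ∣m∣n⇒∣m+n; ∣m⇒∣-m; ∣n⇒∣m*n; ∣m⇒∣m*n; m∣∣m∣)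
  open import Data.Integer.Tactic.RingSolver using (solve-∀)
  open import Algebra.Properties.Semiring.Sum ℤP.+-*-semiring
    using (sum; sum-syntax; sum-cong-≗; ∑-comm; *-distribˡ-sum; *-distribʳ-sum)
  open import Data.Bool using (true; false; if_then_else_)
  open import Data.Sum using (_⊎_; inj₁; inj₂)
  open import Data.Empty using (⊥-elim)
  open import Function using (_∘_)
  open import Relation.Binary.Bundles using (Setoid)
  open import Relation.Nullary using (¬_; yes; no)
  open import Relation.Nullary.Decidable using (isYes; isYes≗does; dec-true; dec-false)

  variable
    n : ℕ

  sumFin≡sum : (f : Fin n → ℤ) → sumFin f ≡ sum f
  sumFin≡sum {ℕ.zero}  f = refl
  sumFin≡sum {ℕ.suc n} f = cong (_+_ (f zero)) (sumFin≡sum (f ∘ suc))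

  ∑-const : ∀ n (c : ℤ) → ∑[ k < n ] c ≡ + n * c
  ∑-const ℕ.zero    c = refl
  ∑-const (ℕ.suc n) c = trans (cong (_+_ c) (∑-const n c)) (sym (ℤP.suc-* (+ n) c))

  ∑-∣ : ∀ {m} (f : Fin n → ℤ) → (∀ k → m ∣ f k) → m ∣ sum f
  ∑-∣ {ℕ.zero}  f h = divides +0 refl
  ∑-∣ {ℕ.suc n} f h = ∣m∣n⇒∣m+n (h zero) (∑-∣ (f ∘ suc) (h ∘ suc))

  ⊗-entry : (A B : Matrix n) (i j : Fin n) → (A ⊗ B) i j ≡ ∑[ k < n ] (A i k * B k j)
  ⊗-entry A B i j = sumFin≡sum (λ k → A i k * B k j)

  δ-suc : (i j : Fin n) → δ (suc i) (suc j) ≡ δ i j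
  δ-suc i j with i Fin.≟ j
  ... | yes _ = refl
  ... | no _  = refl

  δ-sym : (i j : Fin n) → δ i j ≡ δ j i
  δ-sym i j with i Fin.≟ j | j Fin.≟ i
  ... | yes _    | yes _    = refl
  ... | no _     | no _     = refl
  ... | yes refl | no j≢i   = ⊥-elim (j≢i refl)
  ... | no i≢j   | yes refl = ⊥-elim (i≢j refl)

  δ-≢ : {i j : Fin n} → i ≢ j → δ i j ≡ +0
  δ-≢ {i = i} {j} i≢j =
    cong (λ b → if b then + 1 else +0) (trans (isYes≗does (i Fin.≟ j)) (dec-false (i Fin.≟ j) i≢j))

  ∑-δ : (i : Fin n) (f : Fin n → ℤ) → ∑[ k < n ] (δ i k * f k) ≡ f i
  ∑-δ {ℕ.suc n} zero f = begin
    + 1 * f zero + ∑[ k < n ] (+0 * f (suc k)) ≡⟨ cong₂ _+_ (ℤP.*-identityˡ (f zero)) (∑-const n +0) ⟩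
    f zero + + n * +0                           ≡⟨ cong (_+_ (f zero)) (ℤP.*-zeroʳ (+ n)) ⟩
    f zero + +0                                 ≡⟨ ℤP.+-identityʳ (f zero) ⟩
    f zero                                      ∎
    where open ≡-Reasoning
  ∑-δ {ℕ.suc n} (suc i) f = begin
    +0 * f zero + ∑[ k < n ] (δ (suc i) (suc k) * f (suc k)) ≡⟨ ℤP.+-identityˡ _ ⟩
    ∑[ k < n ] (δ (suc i) (suc k) * f (suc k))               ≡⟨ sum-cong-≗ (λ k → cong (_* f (suc k)) (δ-suc i k)) ⟩
    ∑[ k < n ] (δ i k * f (suc k))                           ≡⟨ ∑-δ i (f ∘ suc) ⟩
    f (suc i)                                                ∎
    where open ≡-Reasoning

  ⊗-identityˡ : (A : Matrix n) → identity ⊗ A ≐ A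
  ⊗-identityˡ A i j = trans (⊗-entry identity A i j) (∑-δ i (λ k → A k j))

  ⊗-identityʳ : (A : Matrix n) → A ⊗ identity ≐ A
  ⊗-identityʳ A i j = begin
    (A ⊗ identity) i j        ≡⟨ ⊗-entry A identity i j ⟩
    ∑[ k < _ ] (A i k * δ k j) ≡⟨ sum-cong-≗ (λ k → trans (ℤP.*-comm (A i k) _) (cong (_* A i k) (δ-sym k j))) ⟩
    ∑[ k < _ ] (δ j k * A i k) ≡⟨ ∑-δ j (A i) ⟩
    A i j                      ∎
    where open ≡-Reasoning

  ⊗-assoc : (A B C : Matrix n) → A ⊗ B ⊗ C ≐ A ⊗ (B ⊗ C)
  ⊗-assoc {n} A B C i j = begin
    (A ⊗ B ⊗ C) i j
      ≡⟨ ⊗-entry (A ⊗ B) C i j ⟩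
    ∑[ k < n ] ((A ⊗ B) i k * C k j)
      ≡⟨ sum-cong-≗ {n} (λ k → trans (cong (_* C k j) (⊗-entry A B i k))
                                     (*-distribʳ-sum (C k j) (λ l → A i l * B l k))) ⟩
    ∑[ k < n ] ∑[ l < n ] (A i l * B l k * C k j)
      ≡⟨ ∑-comm (λ k l → A i l * B l k * C k j) ⟩
    ∑[ l < n ] ∑[ k < n ] (A i l * B l k * C k j)
      ≡⟨ sum-cong-≗ {n} (λ l → trans (sum-cong-≗ {n} (λ k → ℤP.*-assoc (A i l) (B l k) (C k j)))
                                      (sym (*-distribˡ-sum (A i l) (λ k → B l k * C k j)))) ⟩
    ∑[ l < n ] (A i l * ∑[ k < n ] (B l k * C k j))
      ≡⟨ sum-cong-≗ (λ l → cong (A i l *_) (sym (⊗-entry B C l j))) ⟩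
    ∑[ l < n ] (A i l * (B ⊗ C) l j)
      ≡⟨ sym (⊗-entry A (B ⊗ C) i j) ⟩
    (A ⊗ (B ⊗ C)) i j ∎
    where open ≡-Reasoning

  ⊗-cong : {A A′ B B′ : Matrix n} → A ≐ A′ → B ≐ B′ → A ⊗ B ≐ A′ ⊗ B′
  ⊗-cong {A = A} {A′} {B} {B′} eA eB i j = begin
    (A ⊗ B) i j                 ≡⟨ ⊗-entry A B i j ⟩
    ∑[ k < _ ] (A i k * B k j)   ≡⟨ sum-cong-≗ (λ k → cong₂ _*_ (eA i k) (eB k j)) ⟩
    ∑[ k < _ ] (A′ i k * B′ k j) ≡⟨ sym (⊗-entry A′ B′ i j) ⟩
    (A′ ⊗ B′) i j               ∎
    where open ≡-Reasoning

  ≐-refl : (A : Matrix n) → A ≐ A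
  ≐-refl A i j = refl

  ≐-setoid : ℕ → Setoid _ _
  ≐-setoid n = record
    { Carrier       = Matrix n
    ; _≈_           = _≐_
    ; isEquivalence = record
      { refl  = ≐-refl _
      ; sym   = λ e i j → sym (e i j)
      ; trans = λ e f i j → trans (e i j) (f i j)
      }
    }

  cancel-outer : {M D P P′ Q Q′ : Matrix n} →
    P′ ⊗ P ≐ identity → Q ⊗ Q′ ≐ identity → P ⊗ M ⊗ Q ≐ D → M ≐ P′ ⊗ D ⊗ Q′
  cancel-outer {n} {M} {D} {P} {P′} {Q} {Q′} P′P QQ′ PMQ = begin
    M                            ≈⟨ ⊗-identityʳ M ⟨
    M ⊗ identity                 ≈⟨ ⊗-cong (≐-refl M) QQ′ ⟨
    M ⊗ (Q ⊗ Q′)                 ≈⟨ ⊗-assoc M Q Q′ ⟨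
    M ⊗ Q ⊗ Q′                   ≈⟨ ⊗-cong (⊗-identityˡ (M ⊗ Q)) (≐-refl Q′) ⟨
    identity ⊗ (M ⊗ Q) ⊗ Q′      ≈⟨ ⊗-cong (⊗-cong P′P (≐-refl (M ⊗ Q))) (≐-refl Q′) ⟨
    P′ ⊗ P ⊗ (M ⊗ Q) ⊗ Q′        ≈⟨ ⊗-cong (⊗-assoc P′ P (M ⊗ Q)) (≐-refl Q′) ⟩
    P′ ⊗ (P ⊗ (M ⊗ Q)) ⊗ Q′      ≈⟨ ⊗-cong (⊗-cong (≐-refl P′) (⊗-assoc P M Q)) (≐-refl Q′) ⟨
    P′ ⊗ (P ⊗ M ⊗ Q) ⊗ Q′        ≈⟨ ⊗-cong (⊗-cong (≐-refl P′) PMQ) (≐-refl Q′) ⟩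
    P′ ⊗ D ⊗ Q′                  ∎
    where open import Relation.Binary.Reasoning.Setoid (≐-setoid n)

  -- A diagonal matrix scales columns, so A · diag(d) · B is a sum of
  -- rank-one terms d_k · (column k of A) · (row k of B).
  ⊗-diag : (A : Matrix n) (d : Fin n → ℤ) (i k : Fin n) → (A ⊗ diag d) i k ≡ A i k * d k
  ⊗-diag A d i k = begin
    (A ⊗ diag d) i k              ≡⟨ ⊗-entry A (diag d) i k ⟩
    ∑[ l < _ ] (A i l * diag d l k) ≡⟨ sum-cong-≗ (λ l → reorder l (isYes (l Fin.≟ k)) (δ-sym l k)) ⟩
    ∑[ l < _ ] (δ k l * (A i l * d l)) ≡⟨ ∑-δ k (λ l → A i l * d l) ⟩
    A i k * d k                   ∎
    where
    open ≡-Reasoning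
    reorder : ∀ l b → (if b then + 1 else +0) ≡ δ k l →
              A i l * (if b then d l else +0) ≡ δ k l * (A i l * d l)
    reorder l true  e = trans (sym (ℤP.*-identityˡ _)) (cong (_* (A i l * d l)) e)
    reorder l false e = trans (ℤP.*-zeroʳ (A i l)) (cong (_* (A i l * d l)) e)

  sandwich : (A B : Matrix n) (d : Fin n → ℤ) (i j : Fin n) →
    (A ⊗ diag d ⊗ B) i j ≡ ∑[ k < n ] (A i k * d k * B k j)
  sandwich A B d i j =
    trans (⊗-entry (A ⊗ diag d) B i j) (sum-cong-≗ (λ k → cong (_* B k j) (⊗-diag A d i k)))

  infix 4 _≡_[mod_]
  _≡_[mod_] : ℤ → ℤ → ℤ → Set
  x ≡ y [mod m ] = Σ ℤ λ q → x ≡ y + q * m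

  mod-resp : ∀ {m x x′ y′ y} → x ≡ x′ → x′ ≡ y′ [mod m ] → y′ ≡ y → x ≡ y [mod m ]
  mod-resp refl x′≡y′ refl = x′≡y′

  mod-*ˡ : ∀ {m x y} (c : ℤ) → x ≡ y [mod m ] → c * x ≡ c * y [mod m ]
  mod-*ˡ {m} {y = y} c (q , refl) = c * q , distrib c y q m
    where
    distrib : ∀ c y q m → c * (y + q * m) ≡ c * y + c * q * m
    distrib = solve-∀

  mod-*ʳ : ∀ {m x y} (c : ℤ) → x ≡ y [mod m ] → x * c ≡ y * c [mod m ]
  mod-*ʳ {m} {y = y} c (q , refl) = q * c , distrib c y q m
    where
    distrib : ∀ c y q m → (y + q * m) * c ≡ y * c + q * c * m
    distrib = solve-∀

  mod-∑ : ∀ {m} (f g : Fin n → ℤ) → (∀ k → f k ≡ g k [mod m ]) → sum f ≡ sum g [mod m ]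
  mod-∑ {ℕ.zero}  f g h = +0 , refl
  mod-∑ {ℕ.suc n} {m} f g h =
    let (q , e) = h zero
        (q′ , e′) = mod-∑ (f ∘ suc) (g ∘ suc) (h ∘ suc)
    in q + q′ , trans (cong₂ _+_ e e′) (regroup (g zero) (sum (g ∘ suc)) q q′ m)
    where
    regroup : ∀ a b q q′ m → a + q * m + (b + q′ * m) ≡ a + b + (q + q′) * m
    regroup = solve-∀

  RankOneMod : ℤ → Matrix n → Set
  RankOneMod {n} m M =
    Σ (Fin n → ℤ) λ u → Σ (Fin n → ℤ) λ v → ∀ i j → M i j ≡ u i * v j [mod m ]

  rankOne-minor : ∀ {m} {M : Matrix n} → RankOneMod m M →
    ∀ i k j l → m ∣ M i j * M k l - M i l * M k j
  rankOne-minor {m = m} (u , v , h) i k j l = minor∣ (h i j) (h k l) (h i l) (h k j)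
    where
    expand : ∀ a b c e p q r s m →
      (a * b + p * m) * (c * e + q * m) - (a * e + r * m) * (c * b + s * m)
      ≡ (a * b * q + p * c * e + p * q * m - a * e * s - r * c * b - r * s * m) * m
    expand = solve-∀
    minor∣ : ∀ {x y z w} → x ≡ u i * v j [mod m ] → y ≡ u k * v l [mod m ] →
      z ≡ u i * v l [mod m ] → w ≡ u k * v j [mod m ] → m ∣ x * y - z * w
    minor∣ (p , refl) (q , refl) (r , refl) (s , refl) = divides
      (u i * v j * q + p * u k * v l + p * q * m - u i * v l * s - r * u k * v j - r * s * m)
      (expand (u i) (v j) (u k) (v l) p q r s m)

  rankOne-≐ : ∀ {m} {M M′ : Matrix n} → M ≐ M′ → RankOneMod m M′ → RankOneMod m M
  rankOne-≐ M≐M′ (u , v , h) = u , v , λ i j → mod-resp {y′ = u i * v j} (M≐M′ i j) (h i j) refl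

  rankOne-⊗ˡ : ∀ {m} (P : Matrix n) {M : Matrix n} → RankOneMod m M → RankOneMod m (P ⊗ M)
  rankOne-⊗ˡ {n} {m} P {M} (u , v , h) = (λ i → ∑[ l < n ] (P i l * u l)) , v , entry
    where
    entry : ∀ i j → (P ⊗ M) i j ≡ ∑[ l < n ] (P i l * u l) * v j [mod m ]
    entry i j =
      mod-resp (⊗-entry P M i j)
        (mod-∑ (λ l → P i l * M l j) (λ l → P i l * (u l * v j)) (λ l → mod-*ˡ {y = u l * v j} (P i l) (h l j)))
        (trans (sum-cong-≗ (λ l → sym (ℤP.*-assoc (P i l) (u l) (v j))))
               (sym (*-distribʳ-sum (v j) (λ l → P i l * u l))))

  rankOne-⊗ʳ : ∀ {m} (Q : Matrix n) {M : Matrix n} → RankOneMod m M → RankOneMod m (M ⊗ Q)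
  rankOne-⊗ʳ {n} {m} Q {M} (u , v , h) = u , (λ j → ∑[ k < n ] (v k * Q k j)) , entry
    where
    entry : ∀ i j → (M ⊗ Q) i j ≡ u i * ∑[ k < n ] (v k * Q k j) [mod m ]
    entry i j =
      mod-resp (⊗-entry M Q i j)
        (mod-∑ (λ k → M i k * Q k j) (λ k → u i * v k * Q k j) (λ k → mod-*ʳ {y = u i * v k} (Q k j) (h i k)))
        (trans (sum-cong-≗ (λ k → ℤP.*-assoc (u i) (v k) (Q k j)))
               (sym (*-distribˡ-sum (u i) (λ k → v k * Q k j))))

  scaled-∣ : ∀ {m x} (a b : ℤ) → m ∣ x → m ∣ a * x * b
  scaled-∣ a b m∣x = ∣m⇒∣m*n b (∣n⇒∣m*n a m∣x)

  sandwich-rankOne : ∀ {m} (A B : Matrix (ℕ.suc n)) (d : Fin (ℕ.suc n) → ℤ) →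
    (∀ k → m ∣ d (suc k)) → RankOneMod m (A ⊗ diag d ⊗ B)
  sandwich-rankOne {n} {m} A B d m∣d = (λ i → A i zero * d zero) , B zero , entry
    where
    entry : ∀ i j → (A ⊗ diag d ⊗ B) i j ≡ A i zero * d zero * B zero j [mod m ]
    entry i j =
      let divides q tail≡ = ∑-∣ (λ k → A i (suc k) * d (suc k) * B (suc k) j)
                                (λ k → scaled-∣ (A i (suc k)) (B (suc k) j) (m∣d k))
      in q , trans (sandwich A B d i j) (cong (_+_ (A i zero * d zero * B zero j)) tail≡)

  sandwich-∣ : ∀ {m} (A B : Matrix n) (d : Fin n → ℤ) → (∀ k → m ∣ d k) →
    ∀ i j → m ∣ (A ⊗ diag d ⊗ B) i j
  sandwich-∣ {m = m} A B d m∣d i j =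
    subst (m ∣_) (sym (sandwich A B d i j))
      (∑-∣ (λ k → A i k * d k * B k j) (λ k → scaled-∣ (A i k) (B k j) (m∣d k)))

  chain-∣ : (d : Fin (ℕ.suc n) → ℤ) →
    (∀ i j → toℕ j ≡ ℕ.suc (toℕ i) → d i Unsigned.∣ d j) → ∀ k → d zero ∣ d k
  chain-∣ d step zero = ∣-refl
  chain-∣ {ℕ.suc n} d step (suc k) =
    ∣-trans (∣ᵤ⇒∣ (step zero (suc zero) refl))
            (chain-∣ (d ∘ suc) (λ i j e → step (suc i) (suc j) (cong ℕ.suc e)) k)

  snf-factor : {M : Matrix n} {d : Fin n → ℤ} → IsSmithNormalForm M d →
    Σ (Matrix n) λ A → Σ (Matrix n) λ B → M ≐ A ⊗ diag d ⊗ B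
  snf-factor {M = M} {d} (_ , _ , P , Q , (P′ , _ , P′P) , (Q′ , QQ′ , _) , PMQ) =
    P′ , Q′ , cancel-outer {M = M} {diag d} {P} {P′} {Q} {Q′} P′P QQ′ PMQ

  first-invariant-∣ : {M : Matrix (ℕ.suc n)} {d : Fin (ℕ.suc n) → ℤ} →
    IsSmithNormalForm M d → ∀ i j → d zero ∣ M i j
  first-invariant-∣ {M = M} {d} snf@(_ , chain , _) i j =
    let (A , B , M≐ADB) = snf-factor {M = M} snf
    in subst (d zero ∣_) (sym (M≐ADB i j)) (sandwich-∣ A B d (chain-∣ d chain) i j)

  second-invariant-rankOne : {M : Matrix (ℕ.suc (ℕ.suc n))} {d : Fin (ℕ.suc (ℕ.suc n)) → ℤ} →
    IsSmithNormalForm M d → RankOneMod (d (suc zero)) M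
  second-invariant-rankOne {M = M} {d} snf@(_ , chain , _) =
    let (A , B , M≐ADB) = snf-factor {M = M} snf
        chain′ i j e = chain (suc i) (suc j) (cong ℕ.suc e)
    in rankOne-≐ M≐ADB (sandwich-rankOne A B d (chain-∣ (d ∘ suc) chain′))

  PlusMinusOne : ℤ → Set
  PlusMinusOne x = x ≡ + 1 ⊎ x ≡ - + 1

  pm1-nonzero : ∀ {a} → PlusMinusOne a → a ≢ +0
  pm1-nonzero (inj₁ refl) ()
  pm1-nonzero (inj₂ refl) ()

  pm1-* : ∀ {a b} → PlusMinusOne a → PlusMinusOne b → PlusMinusOne (a * b)
  pm1-* (inj₁ refl) (inj₁ refl) = inj₁ refl
  pm1-* (inj₁ refl) (inj₂ refl) = inj₂ refl
  pm1-* (inj₂ refl) (inj₁ refl) = inj₂ refl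
  pm1-* (inj₂ refl) (inj₂ refl) = inj₁ refl

  pm1-cancel : ∀ {a} (s : ℤ) → PlusMinusOne a → a * (s * a) ≡ s
  pm1-cancel s (inj₁ refl) = lemma s
    where
    lemma : ∀ s → + 1 * (s * + 1) ≡ s
    lemma = solve-∀
  pm1-cancel s (inj₂ refl) = lemma s
    where
    lemma : ∀ s → - + 1 * (s * - + 1) ≡ s
    lemma = solve-∀

  pm1-minor : ∀ {a b c e} → PlusMinusOne a → PlusMinusOne b → PlusMinusOne c → PlusMinusOne e →
    e ≡ b * a * c ⊎ ∣ a * e - c * b ∣ ≡ 2
  pm1-minor (inj₁ refl) (inj₁ refl) (inj₁ refl) (inj₁ refl) = inj₁ refl
  pm1-minor (inj₁ refl) (inj₁ refl) (inj₁ refl) (inj₂ refl) = inj₂ refl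
  pm1-minor (inj₁ refl) (inj₁ refl) (inj₂ refl) (inj₁ refl) = inj₂ refl
  pm1-minor (inj₁ refl) (inj₁ refl) (inj₂ refl) (inj₂ refl) = inj₁ refl
  pm1-minor (inj₁ refl) (inj₂ refl) (inj₁ refl) (inj₁ refl) = inj₂ refl
  pm1-minor (inj₁ refl) (inj₂ refl) (inj₁ refl) (inj₂ refl) = inj₁ refl
  pm1-minor (inj₁ refl) (inj₂ refl) (inj₂ refl) (inj₁ refl) = inj₁ refl
  pm1-minor (inj₁ refl) (inj₂ refl) (inj₂ refl) (inj₂ refl) = inj₂ refl
  pm1-minor (inj₂ refl) (inj₁ refl) (inj₁ refl) (inj₁ refl) = inj₂ refl
  pm1-minor (inj₂ refl) (inj₁ refl) (inj₁ refl) (inj₂ refl) = inj₁ refl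
  pm1-minor (inj₂ refl) (inj₁ refl) (inj₂ refl) (inj₁ refl) = inj₁ refl
  pm1-minor (inj₂ refl) (inj₁ refl) (inj₂ refl) (inj₂ refl) = inj₂ refl
  pm1-minor (inj₂ refl) (inj₂ refl) (inj₁ refl) (inj₁ refl) = inj₁ refl
  pm1-minor (inj₂ refl) (inj₂ refl) (inj₁ refl) (inj₂ refl) = inj₂ refl
  pm1-minor (inj₂ refl) (inj₂ refl) (inj₂ refl) (inj₁ refl) = inj₂ refl
  pm1-minor (inj₂ refl) (inj₂ refl) (inj₂ refl) (inj₂ refl) = inj₁ refl

  ±1-rankOne : {M : Matrix n} → IsPM1 M → RankOneMod (+ 2) M
  ±1-rankOne pm = (λ _ → + 1) , (λ _ → + 1) , λ i j → odd (pm i j)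
    where
    odd : ∀ {x} → PlusMinusOne x → x ≡ + 1 * + 1 [mod + 2 ]
    odd (inj₁ refl) = +0 , refl
    odd (inj₂ refl) = - + 1 , refl

  -- For a ±1 matrix the first two invariant factors have an even product:
  -- diag(d) = P M Q is of rank one modulo 2, and its leading minor is d₀ d₁.
  ±1-parity : {M : Matrix (ℕ.suc (ℕ.suc n))} {d : Fin (ℕ.suc (ℕ.suc n)) → ℤ} →
    IsPM1 M → IsSmithNormalForm M d → + 2 ∣ d zero * d (suc zero)
  ±1-parity {M = M} {d} pm (_ , _ , P , Q , _ , _ , PMQ) =
    subst (+ 2 ∣_) leading-minor (rankOne-minor rankOne zero (suc zero) zero (suc zero))
    where
    rankOne : RankOneMod (+ 2) (P ⊗ M ⊗ Q)
    rankOne = rankOne-⊗ʳ Q (rankOne-⊗ˡ P (±1-rankOne pm))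
    D = P ⊗ M ⊗ Q
    leading-minor : D zero zero * D (suc zero) (suc zero) - D zero (suc zero) * D (suc zero) zero
                    ≡ d zero * d (suc zero)
    leading-minor = trans
      (cong₂ _-_ (cong₂ _*_ (PMQ zero zero) (PMQ (suc zero) (suc zero)))
                 (cong₂ _*_ (PMQ zero (suc zero)) (PMQ (suc zero) zero)))
      (ℤP.+-identityʳ (d zero * d (suc zero)))

  -- Two orthogonal rows of a ±1 matrix are not proportional, so together
  -- with column 0 some column gives a 2 × 2 minor equal to ±2.
  orthogonal-rows-minor : (M : Matrix (ℕ.suc n)) → IsPM1 M → ∀ i k →
    (M ⊗ transpose M) i k ≡ +0 →
    Σ (Fin (ℕ.suc n)) λ j → ∣ M i zero * M k j - M i j * M k zero ∣ ≡ 2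
  orthogonal-rows-minor {n} M pm i k orthogonal
    with FinP.¬∀⟶∃¬ (ℕ.suc n) (λ j → M k j ≡ s * M i j) (λ j → M k j ℤP.≟ s * M i j) not-proportional
    where
    s = M k zero * M i zero
    inner-product : (∀ j → M k j ≡ s * M i j) → (M ⊗ transpose M) i k ≡ + ℕ.suc n * s
    inner-product prop = begin
      (M ⊗ transpose M) i k          ≡⟨ ⊗-entry M (transpose M) i k ⟩
      ∑[ j < ℕ.suc n ] (M i j * M k j) ≡⟨ sum-cong-≗ (λ j → trans (cong (M i j *_) (prop j)) (pm1-cancel s (pm i j))) ⟩
      ∑[ j < ℕ.suc n ] s             ≡⟨ ∑-const (ℕ.suc n) s ⟩
      + ℕ.suc n * s                  ∎
      where open ≡-Reasoning
    not-proportional : ¬ (∀ j → M k j ≡ s * M i j)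
    not-proportional prop
      with ℤP.i*j≡0⇒i≡0∨j≡0 (+ ℕ.suc n) (trans (sym (inner-product prop)) orthogonal)
    ... | inj₁ ()
    ... | inj₂ s≡0 = pm1-nonzero (pm1-* (pm k zero) (pm i zero)) s≡0
  ... | j , ¬prop with pm1-minor (pm i zero) (pm k zero) (pm i j) (pm k j)
  ...   | inj₁ prop  = ⊥-elim (¬prop prop)
  ...   | inj₂ minor = j , minor

  sameHalf-refl : ∀ h (i : Fin n) → sameHalf h i i ≡ true
  sameHalf-refl h i with firstHalf h i
  ... | true  = refl
  ... | false = refl

  sameHalf-split : ∀ {h} {i j : Fin n} → firstHalf h i ≡ true → firstHalf h j ≡ false →
    sameHalf h i j ≡ false
  sameHalf-split i-first j-second rewrite i-first | j-second = refl

  EWGram-crossHalf : ∀ n (i j : Fin n) → sameHalf (n ℕ./ 2) i j ≡ false → EWGram n i j ≡ +0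
  EWGram-crossHalf n i j apart = begin
    + (n ℕ.∸ 2) * δ i j + (if sameHalf (n ℕ./ 2) i j then + 2 else +0)
      ≡⟨ cong₂ (λ x b → + (n ℕ.∸ 2) * x + (if b then + 2 else +0)) (δ-≢ i≢j) apart ⟩
    + (n ℕ.∸ 2) * +0 + +0
      ≡⟨ cong (_+ +0) (ℤP.*-zeroʳ (+ (n ℕ.∸ 2))) ⟩
    +0 ∎
    where
    open ≡-Reasoning
    i≢j : i ≢ j
    i≢j refl with () ← trans (sym (sameHalf-refl (n ℕ./ 2) i)) apart

  halves-apart : ∀ m → Σ (Fin (ℕ.suc (ℕ.suc m))) λ r → sameHalf (ℕ.suc (ℕ.suc m) ℕ./ 2) zero r ≡ false
  halves-apart m = r , sameHalf-split zero-first r-second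
    where
    h = ℕ.suc (ℕ.suc m) ℕ./ 2
    h-positive : 1 ℕ.≤ h
    h-positive = ℕDiv.m≥n⇒m/n>0 {ℕ.suc (ℕ.suc m)} {2} (ℕ.s≤s (ℕ.s≤s ℕ.z≤n))
    r : Fin (ℕ.suc (ℕ.suc m))
    r = fromℕ< (ℕDiv.m/n<m (ℕ.suc (ℕ.suc m)) 2 (ℕ.s≤s (ℕ.s≤s ℕ.z≤n)))
    zero-first : firstHalf {ℕ.suc (ℕ.suc m)} h zero ≡ true
    zero-first = trans (isYes≗does (1 ℕ.≤? h)) (dec-true (1 ℕ.≤? h) h-positive)
    r-second : firstHalf h r ≡ false
    r-second = trans (isYes≗does (ℕ.suc (toℕ r) ℕ.≤? h))
      (dec-false (ℕ.suc (toℕ r) ℕ.≤? h)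
        (λ h<h → ℕP.<-irrefl refl (subst (λ x → ℕ.suc x ℕ.≤ h) (FinP.toℕ-fromℕ< _) h<h)))

  -- An EW matrix of order n ≥ 2 has a 2 × 2 minor equal to ±2: rows 0 and
  -- n/2 lie in different halves, so they are orthogonal.
  EW-minor : ∀ m (X : Matrix (ℕ.suc (ℕ.suc m))) → IsEW (ℕ.suc (ℕ.suc m)) X →
    Σ (Fin (ℕ.suc (ℕ.suc m))) λ r → Σ (Fin (ℕ.suc (ℕ.suc m))) λ j →
      ∣ X zero zero * X r j - X zero j * X r zero ∣ ≡ 2
  EW-minor m X (pm , gram , _) =
    let (r , apart) = halves-apart m
        orthogonal = trans (gram zero r) (EWGram-crossHalf (ℕ.suc (ℕ.suc m)) zero r apart)
    in r , orthogonal-rows-minor X pm zero r orthogonal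

  ∣-pm1 : ∀ {v a} → v ∣ a → PlusMinusOne a → v ∣ + 1
  ∣-pm1 v∣a (inj₁ refl) = v∣a
  ∣-pm1 v∣a (inj₂ refl) = ∣m⇒∣-m v∣a

  nonneg-∣1 : ∀ {v} → +0 ≤ v → v ∣ + 1 → v ≡ + 1
  nonneg-∣1 (+≤+ _) v∣1 = cong +_ (∣1⇒≡1 (∣⇒∣ᵤ v∣1))

  nonneg-even-∣2 : ∀ {v} → +0 ≤ v → + 2 ∣ v → v ∣ + 2 → v ≡ + 2
  nonneg-even-∣2 (+≤+ _) 2∣v v∣2 = cong +_ (∣-antisym (∣⇒∣ᵤ v∣2) (∣⇒∣ᵤ 2∣v))

  ∣-abs2 : ∀ {v x} → v ∣ x → ∣ x ∣ ≡ 2 → v ∣ + 2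
  ∣-abs2 {v} {x} v∣x abs≡2 = subst (v ∣_) (cong +_ abs≡2) (∣-trans v∣x (m∣∣m∣ {x}))

open IntegerMatrices

open import Data.Nat using (ℕ; _+_; _*_)
import Data.Integer as ℤ
import Data.Integer.Properties as ℤP
open import Data.Integer.Divisibility.Signed using (_∣_)

lemma6p1 : (t : ℕ) (X : Matrix (2 + 4 * t))
    → IsEW (2 + 4 * t) X
    → (x : Fin (2 + 4 * t) → ℤ)
    → InvariantFactors X x
    → (x zero ≡ + 1) × (x (suc zero) ≡ + 2)
lemma6p1 t X ew@(pm , _) x snf@(nonneg , _) = x₀≡1 , x₁≡2
  where
  -- x₀ divides the entry X₀₀ = ±1.
  x₀≡1 : x zero ≡ + 1
  x₀≡1 = nonneg-∣1 (nonneg zero) (∣-pm1 (first-invariant-∣ {M = X} snf zero zero) (pm zero zero))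

  -- x₁ divides every 2 × 2 minor of X, and one of them is ±2.
  x₁∣2 : x (suc zero) ∣ + 2
  x₁∣2 =
    let (r , j , minor≡±2) = EW-minor (4 * t) X ew
    in ∣-abs2 (rankOne-minor (second-invariant-rankOne {M = X} snf) zero r zero j) minor≡±2

  -- x₀ x₁ is even and x₀ = 1.
  2∣x₁ : + 2 ∣ x (suc zero)
  2∣x₁ = subst (+ 2 ∣_) (trans (cong (ℤ._* x (suc zero)) x₀≡1) (ℤP.*-identityˡ (x (suc zero))))
           (±1-parity pm snf)

  x₁≡2 : x (suc zero) ≡ + 2
  x₁≡2 = nonneg-even-∣2 (nonneg (suc zero)) 2∣x₁ x₁∣2
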